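{- Let $(G,\sigma)$ be a properly 2-colored digraph satisfying (N1), (N2) and (N3). Then the set system $\mathcal{R}=\{R(x)\mid x\in V(G)\}$ is hierarchy-like, i.e., $R(x)\cap R(y)\in\{\emptyset,R(x),R(y)\}$ for all $x,y\in V(G)$.
   Context: $G$ is a finite simple digraph with a proper coloring $\sigma\colon V(G)\to\{r,s\}$ (adjacent vertices have distinct colors). $N(x)$ is the out-neighbourhood of $x$ and $N(A)=\bigcup_{x\in A}N(x)$. (N1): for all $x,y$, if $x\notin N(y)$ and $y\notin N(x)$ then $N(x)\cap N(N(y))=N(y)\cap N(N(x))=\emptyset$; (N2): $N(N(N(x)))\subseteq N(x)$; (N3): $N(x)\cap N(y)\ne\emptyset$ implies $N(x)\subseteq N(y)$ or $N(y)\subseteq N(x)$. The reachable set is $R(x)=N(x)\cup N(N(x))\cup N(N(N(x)))\cup\cdots$. -}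

module Defs where

open import Data.Nat using (ℕ)
open import Data.Fin using (Fin)
open import Data.Bool using (Bool; true)
open import Data.Product using (Σ; _×_; ∃-syntax)
open import Data.Sum using (_⊎_)
open import Relation.Binary.PropositionalEquality using (_≡_; _≢_)
open import Relation.Nullary using (¬_)

data Colour : Set where
  r s : Colour

-- A finite simple digraph on vertex set Fin n: arc x y ≡ true means (x,y) is an arc.
-- Simplicity: no loops (multi-arcs are impossible for a Bool-valued relation).
record Digraph (n : ℕ) : Set where
  field
    arc   : Fin n → Fin n → Bool
    loopless : ∀ x → ¬ (arc x x ≡ true)

module _ {n : ℕ} (G : Digraph n) where
  open Digraph G

  VSet : Set₁
  VSet = Fin n → Set

  N : Fin n → VSet
  N x y = arc x y ≡ true

  NS : VSet → VSet
  NS A z = ∃[ w ] (A w × N w z)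

  _∩_ : VSet → VSet → VSet
  (A ∩ B) z = A z × B z

  Empty : VSet → Set
  Empty A = ∀ z → ¬ A z

  _⊆_ : VSet → VSet → Set
  A ⊆ B = ∀ z → A z → B z

  _≐_ : VSet → VSet → Set
  A ≐ B = (A ⊆ B) × (B ⊆ A)

  ProperColouring : (Fin n → Colour) → Set
  ProperColouring σ = ∀ x y → N x y → σ x ≢ σ y

  N1 : Set
  N1 = ∀ x y → ¬ N y x → ¬ N x y →
         Empty (N x ∩ NS (N y)) × Empty (N y ∩ NS (N x))

  N2 : Set
  N2 = ∀ x → NS (NS (N x)) ⊆ N x

  N3 : Set
  N3 = ∀ x y → (∃[ z ] (N x ∩ N y) z) → (N x ⊆ N y) ⊎ (N y ⊆ N x)

  -- R(x) = N(x) ∪ N(N(x)) ∪ ... : vertices reachable from x by a directed walk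
  -- of length ≥ 1.
  data R (x : Fin n) : VSet where
    base : ∀ {z} → N x z → R x z
    step : ∀ {w z} → R x w → N w z → R x z

  HierarchyLike : Set
  HierarchyLike = ∀ x y →
    Empty (R x ∩ R y) ⊎ ((R x ∩ R y) ≐ R x) ⊎ ((R x ∩ R y) ≐ R y)

-- If neither of x, y reaches the other, the sets R(x) and R(y) are nested as soon
-- as N(x) and N(y) meet (by (N3), since R depends monotonically on N), and are
-- disjoint otherwise: by (N2) every reachable vertex lies in N or in N∘N, and the
-- remaining overlaps N(x) ∩ N(N(y)), N(N(x)) ∩ N(y) and N(N(x)) ∩ N(b) for b ∈ N(y)
-- are excluded by (N1). If one of x, y reaches the other, nesting is immediate.
module Submission where

open import Defs

open import Data.Nat using (ℕ)
open import Data.Fin using (Fin)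
open import Data.Fin.Properties using (any?)
open import Data.Bool using (true)
open import Data.Bool.Properties using () renaming (_≟_ to _≟ᵇ_)
open import Data.Empty using (⊥)
open import Data.Product using (_×_; _,_; ∃-syntax; proj₁; proj₂)
open import Data.Sum using (_⊎_; inj₁; inj₂; [_,_])
open import Relation.Nullary using (¬_; Dec; yes; no)
open import Relation.Nullary.Decidable using (_×-dec_; _⊎-dec_; map′)

module _ {n : ℕ} (G : Digraph n) where

  ⊆⇒∩≐ˡ : ∀ {A B} → _⊆_ G A B → _≐_ G (_∩_ G A B) A
  ⊆⇒∩≐ˡ A⊆B = (λ _ → proj₁) , (λ z a → a , A⊆B z a)

  ⊆⇒∩≐ʳ : ∀ {A B} → _⊆_ G B A → _≐_ G (_∩_ G A B) B
  ⊆⇒∩≐ʳ B⊆A = (λ _ → proj₂) , (λ z b → B⊆A z b , b)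

  R-trans : ∀ {x y z} → R G x y → R G y z → R G x z
  R-trans rxy (base yz)     = step rxy yz
  R-trans rxy (step ryw wz) = step (R-trans rxy ryw) wz

  R-reach-⊆ : ∀ {x y} → R G x y → _⊆_ G (R G y) (R G x)
  R-reach-⊆ rxy _ = R-trans rxy

  R-mono : ∀ {x y} → _⊆_ G (N G x) (N G y) → _⊆_ G (R G x) (R G y)
  R-mono N⊆ z (base xz)     = base (N⊆ z xz)
  R-mono N⊆ z (step rxw wz) = step (R-mono N⊆ _ rxw) wz

  N? : ∀ x z → Dec (N G x z)
  N? x z = Digraph.arc G x z ≟ᵇ true

  NS-N? : ∀ x z → Dec (NS G (N G x) z)
  NS-N? x z = any? (λ w → N? x w ×-dec N? w z)

  common? : ∀ x y → Dec (∃[ z ] (_∩_ G (N G x) (N G y)) z)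
  common? x y = any? (λ z → N? x z ×-dec N? y z)

  module _ (n2 : N2 G) where

    R⇒N⊎NN : ∀ {x z} → R G x z → N G x z ⊎ NS G (N G x) z
    R⇒N⊎NN (base xz) = inj₁ xz
    R⇒N⊎NN {x} {z} (step {w} rxw wz) with R⇒N⊎NN rxw
    ... | inj₁ xw  = inj₂ (w , xw , wz)
    ... | inj₂ xxw = inj₁ (n2 x z (w , xxw , wz))

    N⊎NN⇒R : ∀ {x z} → N G x z ⊎ NS G (N G x) z → R G x z
    N⊎NN⇒R (inj₁ xz)            = base xz
    N⊎NN⇒R (inj₂ (w , xw , wz)) = step (base xw) wz

    R? : ∀ x z → Dec (R G x z)
    R? x z = map′ N⊎NN⇒R R⇒N⊎NN (N? x z ⊎-dec NS-N? x z)

    module _ (n1 : N1 G) where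

      R-disjoint : ∀ {x y} → ¬ R G y x → ¬ R G x y → Empty G (_∩_ G (N G x) (N G y)) →
                   Empty G (_∩_ G (R G x) (R G y))
      R-disjoint {x} {y} ¬ryx ¬rxy N-disj z (rxz , ryz) = overlap⇒⊥ (R⇒N⊎NN rxz) (R⇒N⊎NN ryz)
        where
        x⊥y : Empty G (_∩_ G (N G x) (NS G (N G y))) × Empty G (_∩_ G (N G y) (NS G (N G x)))
        x⊥y = n1 x y (λ yx → ¬ryx (base yx)) (λ xy → ¬rxy (base xy))

        overlap⇒⊥ : N G x z ⊎ NS G (N G x) z → N G y z ⊎ NS G (N G y) z → ⊥
        overlap⇒⊥ (inj₁ xz)  (inj₁ yz)  = N-disj z (xz , yz)
        overlap⇒⊥ (inj₁ xz)  (inj₂ yyz) = proj₁ x⊥y z (xz , yyz)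
        overlap⇒⊥ (inj₂ xxz) (inj₁ yz)  = proj₂ x⊥y z (yz , xxz)
        overlap⇒⊥ (inj₂ xxz) (inj₂ (b , yb , bz)) = proj₂ x⊥b z (bz , xxz)
          where
          x⊥b : Empty G (_∩_ G (N G x) (NS G (N G b))) × Empty G (_∩_ G (N G b) (NS G (N G x)))
          x⊥b = n1 x b (λ bx → ¬ryx (step (base yb) bx)) (λ xb → N-disj b (xb , yb))

      hierarchyLike : N3 G → HierarchyLike G
      hierarchyLike n3 x y with R? x y | R? y x | common? x y
      ... | yes rxy | _       | _ = inj₂ (inj₂ (⊆⇒∩≐ʳ (R-reach-⊆ rxy)))
      ... | no _    | yes ryx | _ = inj₂ (inj₁ (⊆⇒∩≐ˡ (R-reach-⊆ ryx)))
      ... | no _    | no _    | yes c =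
        [ (λ Nx⊆Ny → inj₂ (inj₁ (⊆⇒∩≐ˡ (R-mono Nx⊆Ny))))
        , (λ Ny⊆Nx → inj₂ (inj₂ (⊆⇒∩≐ʳ (R-mono Ny⊆Nx)))) ] (n3 x y c)
      ... | no ¬rxy | no ¬ryx | no ¬c = inj₁ (R-disjoint ¬ryx ¬rxy (λ z p → ¬c (z , p)))

lemma13 : (n : ℕ) (G : Digraph n) (σ : Fin n → Colour) →
    ProperColouring G σ → N1 G → N2 G → N3 G → HierarchyLike G
lemma13 n G σ _ n1 n2 n3 = hierarchyLike G n2 n1 n3
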